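{- Let $c$ be a positive integer and $r_1,\ldots,r_c,s_1,\ldots,s_c\ge 2$ integers. Then \[\overline{R}(\mathcal{S}_{r_1,s_1},\ldots,\mathcal{S}_{r_c,s_c})>2^{c-1}\left(\max\{r_1+s_1-1,\ldots,r_c+s_c-1\}-1\right).\]
   Context: An ordered graph is a finite simple graph with a total ordering of its vertices; copies must preserve edges and orderings. For positive integers $r,s$, $\mathcal{S}_{r,s}$ is the ordered star on $r+s-1$ vertices with a central vertex adjacent to all others, having $r-1$ vertices to its right and $s-1$ vertices to its left. $\mathcal{K}_N$ is the complete graph on $N$ totally ordered vertices; $\overline{R}(\mathcal{H}_1,\ldots,\mathcal{H}_c)$ is the smallest $N$ such that every coloring of the edges of $\mathcal{K}_N$ with colors $1,\ldots,c$ contains, for some $i$, a copy of $\mathcal{H}_i$ in color $i$. -}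

module Defs where

open import Data.Nat using (ℕ; zero; suc; _+_; _∸_; _⊔_)
open import Data.Fin using (Fin; toℕ; _<_)
open import Data.Product using (Σ; _×_; ∃; ∃-syntax)
open import Data.Sum using (_⊎_; inj₁; inj₂)
open import Data.Empty using (⊥)
open import Relation.Binary.PropositionalEquality using (_≡_; _≢_; refl)
open import Level using (0ℓ)
open import Relation.Binary using (Rel)
open import Function using (_∘_)

-- An ordered graph: vertex set Fin n, totally ordered by the natural order
-- of Fin, with a simple (irreflexive, symmetric) adjacency relation.
record OrderedGraph : Set₁ where
  field
    size   : ℕ
    Adj    : Rel (Fin size) 0ℓ
    irrefl : ∀ {a} → Adj a a → ⊥
    sym    : ∀ {a b} → Adj a b → Adj b a
open OrderedGraph public

-- The ordered star S_{r,s}: r+s-1 vertices, the centre is the vertex with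
-- index s-1 (so s-1 vertices to its left, r-1 to its right), adjacent to
-- all other vertices, and no other edges.
StarAdj : (r s : ℕ) → Rel (Fin (r + s ∸ 1)) 0ℓ
StarAdj r s a b = (toℕ a ≡ s ∸ 1 ⊎ toℕ b ≡ s ∸ 1) × a ≢ b

Star : ℕ → ℕ → OrderedGraph
Star r s = record
  { size   = r + s ∸ 1
  ; Adj    = StarAdj r s
  ; irrefl = λ p → Data.Product.proj₂ p refl
  ; sym    = λ { (Data.Sum.inj₁ x Data.Product., ne) → inj₂ x Data.Product., (ne ∘ Relation.Binary.PropositionalEquality.sym)
               ; (Data.Sum.inj₂ x Data.Product., ne) → inj₁ x Data.Product., (ne ∘ Relation.Binary.PropositionalEquality.sym) }
  }
  where import Data.Product; import Data.Sum; import Relation.Binary.PropositionalEquality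

-- An edge colouring of the complete ordered graph K_N with colours Fin c.
-- The colour of the edge {u,v} with u < v is χ u v (values with u ≥ v are
-- irrelevant).
Colouring : ℕ → ℕ → Set
Colouring N c = Fin N → Fin N → Fin c

CopyIn : ∀ {N c} → OrderedGraph → Colouring N c → Fin c → Set
CopyIn {N} H χ i =
  Σ (Fin (size H) → Fin N) λ f →
    (∀ {a b} → a < b → f a < f b) ×
    (∀ {a b} → a < b → Adj H a b → χ (f a) (f b) ≡ i)

-- K_N → (H_1, …, H_c): every c-colouring of K_N contains, for some i,
-- a copy of H_i in colour i.  R̄(H_1,…,H_c) is the least such N.
Arrows : ∀ {c} → ℕ → (Fin c → OrderedGraph) → Set
Arrows {c} N H = (χ : Colouring N c) → ∃[ i ] CopyIn (H i) χ i

maxF : ∀ {c} → (Fin c → ℕ) → ℕ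
maxF {zero}  f = 0
maxF {suc c} f = f Fin.zero ⊔ maxF {c} (f ∘ Fin.suc)
  where import Data.Fin as Fin

module Submission where

-- Let M be the largest star size r_j + s_j - 1 and L = M - 1.  When
-- N ≤ 2^m L we exhibit a colouring of K_N with no copy of S_{r_i,s_i} in
-- colour i.  Split the N vertices into 2^m consecutive blocks of size L;
-- edges inside a block get colour j, and an edge between blocks p ≠ q gets
-- the colour indexed by the highest binary digit in which p and q differ
-- (colours renamed by the transposition 0 ↔ j).  This "level" is an
-- ultrametric: on p ≤ q ≤ t the levels of (p,q) and (q,t) can only agree
-- when both are 0.  A star S_{r,s} with r, s ≥ 2 has a vertex on each side
-- of its centre, so a monochromatic copy forces colour j and puts its
-- first vertex, its centre and its last vertex into one block; but an
-- increasing embedding of r + s - 1 ≥ M vertices cannot fit into a block of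
-- L < M vertices.

open import Defs hiding (sym)
open import Data.Nat
  using (ℕ; zero; suc; _+_; _∸_; _*_; _^_; _≤_; _<_; z≤n; s≤s; NonZero; >-nonZero)
open import Data.Nat.Properties
open import Data.Nat.DivMod using (_/_; _%_; m≡m%n+[m/n]*n; m%n<n; m/n*n≤m; /-monoˡ-≤; m<n*o⇒m/o<n)
open import Data.Fin using (Fin; toℕ; fromℕ<) renaming (zero to fz; suc to fs)
import Data.Fin as F
import Data.Fin.Properties as FP
open import Data.Fin.Permutation.Components using (transpose; transpose-inverse)
open import Data.Product using (_,_; _×_; ∃-syntax; proj₁; proj₂)
open import Data.Sum using (inj₁; inj₂)
open import Relation.Binary.PropositionalEquality
open import Relation.Nullary using (yes; no)
open import Data.Empty using (⊥; ⊥-elim)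
open import Function using (_∘_)

same-quotient⇒close : ∀ n .{{_ : NonZero n}} x z → x / n ≡ z / n → z < x + n
same-quotient⇒close n x z same = begin-strict
  z                      ≡⟨ m≡m%n+[m/n]*n z n ⟩
  z % n + (z / n) * n    <⟨ +-monoˡ-< _ (m%n<n z n) ⟩
  n + (z / n) * n        ≡⟨ cong (λ t → n + t * n) (sym same) ⟩
  n + (x / n) * n        ≤⟨ +-monoʳ-≤ n (m/n*n≤m x n) ⟩
  n + x                  ≡⟨ +-comm n x ⟩
  x + n                  ∎
  where open ≤-Reasoning

half-bound : ∀ m a → a < 2 ^ suc m → a / 2 < 2 ^ m
half-bound m a a<2^[1+m] = m<n*o⇒m/o<n (subst (a <_) (*-comm 2 (2 ^ m)) a<2^[1+m])

distinct-triple-halves : ∀ {a b c} → a < b → b < c → a / 2 ≡ c / 2 → ⊥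
distinct-triple-halves {a} {b} {c} a<b b<c same =
  <-irrefl refl (<-≤-trans (same-quotient⇒close 2 a c same) a+2≤c)
  where
  a+2≤c : a + 2 ≤ c
  a+2≤c = subst (_≤ c) (+-comm 2 a) (<-≤-trans (s≤s a<b) b<c)

-- The level of a pair of numbers below 2^m: 0 if they are equal, and
-- otherwise 1 + the position of the highest binary digit where they differ.
level : (m : ℕ) → ℕ → ℕ → Fin (suc m)
level zero    a b = fz
level (suc m) a b with a ≟ b
... | yes _ = fz
... | no  _ = fs (level m (a / 2) (b / 2))

level-zero⇒equal : ∀ m {a b} → a < 2 ^ m → b < 2 ^ m → level m a b ≡ fz → a ≡ b
level-zero⇒equal zero {zero}  {zero}  _         _         _ = refl
level-zero⇒equal zero {suc _} {_}     (s≤s ())  _         _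
level-zero⇒equal zero {zero}  {suc _} _         (s≤s ())  _
level-zero⇒equal (suc m) {a} {b} _ _ _ with a ≟ b
... | yes a≡b = a≡b
level-zero⇒equal (suc m) {a} {b} _ _ () | no _

level-ultrametric : ∀ m {a b c} → a ≤ b → b ≤ c →
  a < 2 ^ m → b < 2 ^ m → c < 2 ^ m →
  level m a b ≡ level m b c → level m a b ≡ fz
level-ultrametric zero _ _ _ _ _ _ = refl
level-ultrametric (suc m) {a} {b} {c} a≤b b≤c a< b< c< same with a ≟ b | b ≟ c
... | yes _   | _       = refl
level-ultrametric (suc m) _ _ _ _ _ () | no _ | yes _
... | no a≢b  | no b≢c  =
  ⊥-elim (distinct-triple-halves (≤∧≢⇒< a≤b a≢b) (≤∧≢⇒< b≤c b≢c) (trans half-a≡half-b half-b≡half-c))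
  where
  a/2< : a / 2 < 2 ^ m
  a/2< = half-bound m a a<
  b/2< : b / 2 < 2 ^ m
  b/2< = half-bound m b b<
  c/2< : c / 2 < 2 ^ m
  c/2< = half-bound m c c<
  same-halves : level m (a / 2) (b / 2) ≡ level m (b / 2) (c / 2)
  same-halves = FP.suc-injective same
  lower-zero : level m (a / 2) (b / 2) ≡ fz
  lower-zero = level-ultrametric m (/-monoˡ-≤ 2 a≤b) (/-monoˡ-≤ 2 b≤c) a/2< b/2< c/2< same-halves
  half-a≡half-b : a / 2 ≡ b / 2
  half-a≡half-b = level-zero⇒equal m a/2< b/2< lower-zero
  half-b≡half-c : b / 2 ≡ c / 2
  half-b≡half-c = level-zero⇒equal m b/2< c/2< (trans (sym same-halves) lower-zero)

transpose-injective : ∀ {n} (i j : Fin n) {x y} → transpose i j x ≡ transpose i j y → x ≡ y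
transpose-injective i j {x} {y} eq = begin
  x                                  ≡⟨ sym (transpose-inverse j i) ⟩
  transpose j i (transpose i j x)    ≡⟨ cong (transpose j i) eq ⟩
  transpose j i (transpose i j y)    ≡⟨ transpose-inverse j i ⟩
  y                                  ∎
  where open ≡-Reasoning

Increasing : ∀ {n N} → (Fin n → Fin N) → Set
Increasing f = ∀ {a b} → a F.< b → f a F.< f b

fromℕ<-mono : ∀ {n k l} (k<n : k < n) (l<n : l < n) → k < l → fromℕ< k<n F.< fromℕ< l<n
fromℕ<-mono k<n l<n k<l = subst₂ _<_ (sym (FP.toℕ-fromℕ< k<n)) (sym (FP.toℕ-fromℕ< l<n)) k<l

increasing-spread : ∀ {n N} (f : Fin (suc n) → Fin N) → Increasing f →
  ∀ k (k<n : k < suc n) → k + toℕ (f fz) ≤ toℕ (f (fromℕ< k<n))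
increasing-spread f f-inc zero    _     = ≤-refl
increasing-spread f f-inc (suc k) k+1<n =
  ≤-trans (s≤s (increasing-spread f f-inc k k<n)) (f-inc (fromℕ<-mono k<n k+1<n ≤-refl))
  where
  k<n : k < suc _
  k<n = <-trans (n<1+n k) k+1<n

spoke-into-centre : ∀ {r s} {a b : Fin (r + s ∸ 1)} → a F.< b → toℕ b ≡ s ∸ 1 → StarAdj r s a b
spoke-into-centre a<b b-centre = inj₂ b-centre , λ a≡b → <-irrefl (cong toℕ a≡b) a<b

spoke-from-centre : ∀ {r s} {a b : Fin (r + s ∸ 1)} → a F.< b → toℕ a ≡ s ∸ 1 → StarAdj r s a b
spoke-from-centre a<b a-centre = inj₁ a-centre , λ a≡b → <-irrefl (cong toℕ a≡b) a<b

module StarVertices (r′ s′ : ℕ) where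
  r s last : ℕ
  r    = suc (suc r′)
  s    = suc (suc s′)
  last = r′ + s

  centre<n : suc s′ < suc last
  centre<n = s≤s (≤-trans (n≤1+n _) (m≤n+m _ r′))
  right<n : suc (suc s′) < suc last
  right<n = s≤s (m≤n+m _ r′)
  last<n : last < suc last
  last<n = ≤-refl

  first centre right final : Fin (suc last)
  first  = fz
  centre = fromℕ< centre<n
  right  = fromℕ< right<n
  final  = fromℕ< last<n

  is-centre : toℕ centre ≡ s ∸ 1
  is-centre = FP.toℕ-fromℕ< centre<n

  first<centre : first F.< centre
  first<centre = fromℕ<-mono (s≤s z≤n) centre<n (s≤s z≤n)
  centre<right : centre F.< right
  centre<right = fromℕ<-mono centre<n right<n ≤-refl
  centre<final : centre F.< final
  centre<final = fromℕ<-mono centre<n last<n (m≤n+m _ r′)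

  first–centre : StarAdj r s first centre
  first–centre = spoke-into-centre {r} {s} first<centre is-centre
  centre–right : StarAdj r s centre right
  centre–right = spoke-from-centre {r} {s} centre<right is-centre
  centre–final : StarAdj r s centre final
  centre–final = spoke-from-centre {r} {s} centre<final is-centre

maxF-attained : ∀ {c} (f : Fin (suc c) → ℕ) → ∃[ j ] maxF f ≡ f j
maxF-attained {zero} f = fz , ⊔-identityʳ (f fz)
maxF-attained {suc c} f with ⊔-sel (f fz) (maxF (f ∘ fs)) | maxF-attained (f ∘ fs)
... | inj₁ max≡head | _            = fz , max≡head
... | inj₂ max≡tail | j , tail≡fj = fs j , trans max≡tail tail≡fj

-- The block colouring of K_N with N ≤ 2^m L, using colours Fin (m+1),
-- where colour j is reserved for the edges inside a block.
module BlockColouring (m L : ℕ) .{{_ : NonZero L}} (j : Fin (suc m)) (N : ℕ) (N≤2^mL : N ≤ 2 ^ m * L) where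

  block : Fin N → ℕ
  block x = toℕ x / L

  block-bound : ∀ x → block x < 2 ^ m
  block-bound x = m<n*o⇒m/o<n (<-≤-trans (FP.toℕ<n x) N≤2^mL)

  block-mono : ∀ {x y} → x F.< y → block x ≤ block y
  block-mono x<y = /-monoˡ-≤ L (<⇒≤ x<y)

  colour : Colouring N (suc m)
  colour x y = transpose fz j (level m (block x) (block y))

  colour-j⇒same-block : ∀ {x y} → colour x y ≡ j → block x ≡ block y
  colour-j⇒same-block {x} {y} col≡j =
    level-zero⇒equal m (block-bound x) (block-bound y) (transpose-injective fz j col≡j)

  monochromatic-path⇒j : ∀ {x y z} → x F.< y → y F.< z → colour x y ≡ colour y z → colour x y ≡ j
  monochromatic-path⇒j {x} {y} {z} x<y y<z same =
    cong (transpose fz j)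
      (level-ultrametric m (block-mono x<y) (block-mono y<z)
        (block-bound x) (block-bound y) (block-bound z) (transpose-injective fz j same))

  -- A copy of S_{r,s} (r, s ≥ 2) in colour i forces i = j and r + s - 1 ≤ L:
  -- the two edges at the centre give colour j, and then first vertex, centre
  -- and last vertex share a block, which is too short for the whole star.
  star-copy : ∀ {i} r s → 2 ≤ r → 2 ≤ s → CopyIn (Star r s) colour i → i ≡ j × r + s ∸ 1 ≤ L
  star-copy {i} (suc (suc r′)) (suc (suc s′)) (s≤s (s≤s _)) (s≤s (s≤s _)) (f , f-inc , f-col) = i≡j , size≤L
    where
    open StarVertices r′ s′
    left-edge : colour (f first) (f centre) ≡ i
    left-edge = f-col first<centre first–centre
    right-edge : colour (f centre) (f right) ≡ i
    right-edge = f-col centre<right centre–right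
    final-edge : colour (f centre) (f final) ≡ i
    final-edge = f-col centre<final centre–final
    i≡j : i ≡ j
    i≡j = trans (sym left-edge)
            (monochromatic-path⇒j (f-inc first<centre) (f-inc centre<right) (trans left-edge (sym right-edge)))
    first~final : block (f first) ≡ block (f final)
    first~final = trans (colour-j⇒same-block (trans left-edge i≡j))
                        (colour-j⇒same-block (trans final-edge i≡j))
    size≤L : suc last ≤ L
    size≤L = +-cancelʳ-≤ (toℕ (f first)) (suc last) L (begin-strict
      last + toℕ (f first)   ≤⟨ increasing-spread f f-inc last last<n ⟩
      toℕ (f final)          <⟨ same-quotient⇒close L (toℕ (f first)) (toℕ (f final)) first~final ⟩
      toℕ (f first) + L      ≡⟨ +-comm (toℕ (f first)) L ⟩
      L + toℕ (f first)      ∎)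
      where open ≤-Reasoning

star-size : ∀ {r s} → 2 ≤ r → 2 ≤ s → 3 ≤ r + s ∸ 1
star-size {suc (suc r′)} {suc (suc s′)} (s≤s (s≤s _)) (s≤s (s≤s _)) = s≤s (≤-trans (s≤s (s≤s z≤n)) (m≤n+m _ r′))

corollary2 : (c : ℕ) → 1 ≤ c → (r s : Fin c → ℕ) →
    (∀ i → 2 ≤ r i) → (∀ i → 2 ≤ s i) →
    (N : ℕ) → Arrows N (λ i → Star (r i) (s i)) →
    2 ^ (c ∸ 1) * (maxF (λ i → r i + s i ∸ 1) ∸ 1) < N
corollary2 (suc m) _ r s r≥2 s≥2 N arrows with 2 ^ m * (maxF (λ i → r i + s i ∸ 1) ∸ 1) <? N
... | yes bound = bound
... | no ¬bound = ⊥-elim (<-irrefl refl (<-≤-trans M-1<M M≤M-1))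
  where
  order : Fin (suc m) → ℕ
  order i = r i + s i ∸ 1
  M : ℕ
  M = maxF order
  largest : ∃[ j ] M ≡ order j
  largest = maxF-attained order
  j : Fin (suc m)
  j = proj₁ largest
  M≥3 : 3 ≤ M
  M≥3 = subst (3 ≤_) (sym (proj₂ largest)) (star-size (r≥2 j) (s≥2 j))
  L>0 : 0 < M ∸ 1
  L>0 = ∸-monoˡ-< (≤-trans (s≤s (s≤s z≤n)) M≥3) ≤-refl
  M-1<M : M ∸ 1 < M
  M-1<M = ∸-monoʳ-< {o = 0} (s≤s z≤n) (≤-trans (s≤s z≤n) M≥3)
  open BlockColouring m (M ∸ 1) {{>-nonZero L>0}} j N (≮⇒≥ ¬bound)
  copy : ∃[ i ] CopyIn (Star (r i) (s i)) colour i
  copy = arrows colour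
  i : Fin (suc m)
  i = proj₁ copy
  star-fits : i ≡ j × order i ≤ M ∸ 1
  star-fits = star-copy (r i) (s i) (r≥2 i) (s≥2 i) (proj₂ copy)
  M≤M-1 : M ≤ M ∸ 1
  M≤M-1 = subst (_≤ M ∸ 1) (trans (cong order (proj₁ star-fits)) (sym (proj₂ largest))) (proj₂ star-fits)
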